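{- (i) For every integer $n>1$, \[ \sum_{i=0}^{n}\binom{n-2+i}{n-2}\,b_i\,D_{\phi_{n-1+i}}(\phi_{n+1-i})=0. \] (ii) With the convention $b_i=0$ for $i<0$, for all integers $n,p\geq2$, \[ \sum_{i=1}^{n+p-1}\left(\binom{i-1}{i-p+1}\frac{b_{i-p+1}}{p-1}+\binom{i-1}{i-n+1}\frac{b_{i-n+1}}{n-1}\right)D_{\phi_i}(\phi_{n+p-i})=0. \]
   Context: Let $\mathcal L$ be the free Lie algebra over $\mathbb Q$ on two generators $a,b$, with Lie bracket $[\cdot,\cdot]$, and let $\mathrm{ad}_a(x)=[a,x]$. For $n\geq 1$ set $\phi_n=\frac{1}{(n-1)!}\mathrm{ad}_a^{\,n-1}(b)$. For $f\in\mathcal L$, $D_f$ denotes the unique derivation of $\mathcal L$ with $D_f(a)=[f,a]$ and $D_f(b)=0$. The Bernoulli numbers $b_i$ are defined by $\frac{u}{e^u-1}=\sum_{i\geq0}b_i\frac{u^i}{i!}$. Binomial coefficients $\binom{m}{j}$ with $j<0$ are $0$. -}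

module Defs where

open import Data.Nat as ℕ using (ℕ; zero; suc; _∸_; _≤ᵇ_; _≡ᵇ_)
open import Data.Nat.Combinatorics using (_C_)
open import Data.Nat.Base using (_!)
open import Data.Nat.Properties using (_!≢0)
open import Data.Integer using (+_)
open import Data.Rational using (ℚ; 0ℚ; 1ℚ; _+_; _*_; _/_)
open import Data.List using (List; foldr; applyUpTo)
open import Data.Bool using (if_then_else_)
open import Relation.Binary.PropositionalEquality using (_≡_)

-- The free Lie algebra over ℚ on two generators a, b, presented as
-- Lie-algebra expressions modulo the smallest congruence that makes
-- them a Lie algebra over ℚ (a setoid, since there are no quotients).

data Gen : Set where
  a b : Gen

infixl 6 _+ᴸ_
infixr 7 _·ᴸ_

data Lie : Set where
  gen   : Gen → Lie
  0ᴸ    : Lie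
  _+ᴸ_  : Lie → Lie → Lie
  _·ᴸ_  : ℚ → Lie → Lie
  ⁅_,_⁆ : Lie → Lie → Lie

-ᴸ_ : Lie → Lie
-ᴸ x = (0ℚ Data.Rational.- 1ℚ) ·ᴸ x

infix 4 _≈_

data _≈_ : Lie → Lie → Set where
  ≈-refl  : ∀ {x} → x ≈ x
  ≈-sym   : ∀ {x y} → x ≈ y → y ≈ x
  ≈-trans : ∀ {x y z} → x ≈ y → y ≈ z → x ≈ z
  +-cong  : ∀ {x x′ y y′} → x ≈ x′ → y ≈ y′ → x +ᴸ y ≈ x′ +ᴸ y′
  ·-cong  : ∀ {c x x′} → x ≈ x′ → c ·ᴸ x ≈ c ·ᴸ x′
  br-cong : ∀ {x x′ y y′} → x ≈ x′ → y ≈ y′ → ⁅ x , y ⁆ ≈ ⁅ x′ , y′ ⁆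
  +-assoc    : ∀ x y z → (x +ᴸ y) +ᴸ z ≈ x +ᴸ (y +ᴸ z)
  +-comm     : ∀ x y → x +ᴸ y ≈ y +ᴸ x
  +-identity : ∀ x → 0ᴸ +ᴸ x ≈ x
  +-inverse  : ∀ x → (-ᴸ x) +ᴸ x ≈ 0ᴸ
  ·-assoc    : ∀ c d x → (c * d) ·ᴸ x ≈ c ·ᴸ (d ·ᴸ x)
  ·-identity : ∀ x → 1ℚ ·ᴸ x ≈ x
  ·-distribˡ : ∀ c x y → c ·ᴸ (x +ᴸ y) ≈ c ·ᴸ x +ᴸ c ·ᴸ y
  ·-distribʳ : ∀ c d x → (c + d) ·ᴸ x ≈ c ·ᴸ x +ᴸ d ·ᴸ x
  br-+ˡ : ∀ x y z → ⁅ x +ᴸ y , z ⁆ ≈ ⁅ x , z ⁆ +ᴸ ⁅ y , z ⁆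
  br-+ʳ : ∀ x y z → ⁅ x , y +ᴸ z ⁆ ≈ ⁅ x , y ⁆ +ᴸ ⁅ x , z ⁆
  br-·ˡ : ∀ c x y → ⁅ c ·ᴸ x , y ⁆ ≈ c ·ᴸ ⁅ x , y ⁆
  br-·ʳ : ∀ c x y → ⁅ x , c ·ᴸ y ⁆ ≈ c ·ᴸ ⁅ x , y ⁆
  br-alt  : ∀ x → ⁅ x , x ⁆ ≈ 0ᴸ
  jacobi  : ∀ x y z → ⁅ x , ⁅ y , z ⁆ ⁆ +ᴸ ⁅ y , ⁅ z , x ⁆ ⁆ +ᴸ ⁅ z , ⁅ x , y ⁆ ⁆ ≈ 0ᴸ

ad-a : Lie → Lie
ad-a x = ⁅ gen a , x ⁆

ad-a^ : ℕ → Lie → Lie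
ad-a^ zero    x = x
ad-a^ (suc m) x = ad-a (ad-a^ m x)

inv! : ℕ → ℚ
inv! m = + 1 / (m !)
  where instance _ = m !≢0

-- φ_n = (1/(n-1)!) ad_a^(n-1)(b) for n ≥ 1  (φ 0 is never used)
φ : ℕ → Lie
φ zero    = 0ᴸ
φ (suc m) = inv! m ·ᴸ ad-a^ m (gen b)

D : Lie → Lie → Lie
D f (gen a)     = ⁅ f , gen a ⁆
D f (gen b)     = 0ᴸ
D f 0ᴸ          = 0ᴸ
D f (x +ᴸ y)    = D f x +ᴸ D f y
D f (c ·ᴸ x)    = c ·ᴸ D f x
D f ⁅ x , y ⁆   = ⁅ D f x , y ⁆ +ᴸ ⁅ x , D f y ⁆

range : ℕ → ℕ → List ℕ          -- [lo, lo+1, ..., hi]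
range lo hi = applyUpTo (lo ℕ.+_) (suc hi ∸ lo)

ΣL : ℕ → ℕ → (ℕ → Lie) → Lie
ΣL lo hi f = foldr (λ i acc → f i +ᴸ acc) 0ᴸ (range lo hi)

Σℚ : ℕ → ℕ → (ℕ → ℚ) → ℚ
Σℚ lo hi f = foldr (λ i acc → f i + acc) 0ℚ (range lo hi)

fromℕ : ℕ → ℚ
fromℕ n = + n / 1

-- Bernoulli numbers: u/(e^u - 1) = Σ b_i u^i / i!, i.e. coefficientwise
-- (Σ_i b_i u^i/i!) * (Σ_{j≥1} u^j/j!) = u.

IsBernoulli : (ℕ → ℚ) → Set
IsBernoulli β = ∀ n →
  Σℚ 0 n (λ i → if n ≤ᵇ i then 0ℚ else β i * inv! i * inv! (n ∸ i))
    ≡ (if n ≡ᵇ 1 then 1ℚ else 0ℚ)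

-- 1/k for k ≥ 1 (only used with k ≥ 1; value at 0 irrelevant)
recip : ℕ → ℚ
recip zero    = 0ℚ
recip (suc k) = + 1 / suc k

-- binom(i-1, i-q+1) * b_{i-q+1} / (q-1), with b_j = 0 and binom = 0 for j < 0
coef : (ℕ → ℚ) → ℕ → ℕ → ℚ
coef β q i = if q ≤ᵇ suc i
             then fromℕ ((i ∸ 1) C (suc i ∸ q)) * β (suc i ∸ q) * recip (q ∸ 1)
             else 0ℚ

-- Write eₘ = ad_a^m b, so that φ (m + 1) = eₘ / m!.  The derivation D_{φ (k+1)} kills b and sends a
-- to - e_{k+1} / k!, so induction on m, driven by Pascal's rule, gives
--   D_{φ (k+1)} (φ (m+1)) = - Σ_{k < j ≤ k+m} ⁅ e_j , e_{k+m-j} ⁆ / (k! (j-k)! (k+m-j)!).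
-- Hence in Σ_t C(A+t, t) b_t D_{φ (A+t+1)} (φ (M-t+1)) the coefficient of ⁅ e_j , e_{A+M-j} ⁆ is
-- - 1/(A! (A+M-j)!) · Σ_t b_t / (t! (j-A-t)!), which by the defining recursion of the Bernoulli numbers
-- vanishes unless j = A + 1.  Identity (i) is one such sum, whose surviving bracket ⁅ e_{n-1} , e_{n-1} ⁆
-- is 0.  In (ii) the two halves of the sum are such sums up to the factors 1/(p-1) and 1/(n-1); they leave
-- ⁅ e_{p-1} , e_{n-1} ⁆ and ⁅ e_{n-1} , e_{p-1} ⁆ with the same coefficient - 1/((n-1)! (p-1)!), which cancel.

module Submission where

open import Defs
open import Algebra.Bundles using (AbelianGroup; CommutativeMonoid)
open import Algebra.Structures using (IsAbelianGroup)
import Algebra.Consequences.Setoid as Consequences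
import Algebra.Properties.Group as GroupProperties
import Algebra.Properties.CommutativeSemigroup as CommutativeSemigroupProperties
open import Data.Bool using (true; false; if_then_else_)
open import Data.Empty using (⊥-elim)
open import Data.Integer as ℤ using (+_)
import Data.Integer.Properties as ℤ
open import Data.List using (foldr; applyUpTo)
open import Data.Nat using (ℕ; zero; suc; _+_; _*_; _∸_; _≤_; _<_; z≤n; s≤s; _≤ᵇ_; _≡ᵇ_; _≤?_; _≟_; _!; NonZero)
import Data.Nat.Properties as ℕ
open import Data.Nat.Combinatorics using (_C_; nCk≡n!/k![n-k]!; k![n∸k]!∣n!; nCk+nC[k+1]≡[n+1]C[k+1]; k>n⇒nCk≡0; nCk≡nC[n∸k])
import Data.Nat.Coprimality as Coprimality
import Data.Nat.DivMod as ℕ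
open import Data.Product using (_×_; _,_)
open import Data.Rational using (ℚ; mkℚ; 0ℚ; 1ℚ; -_; 1/_; _/_) renaming (_+_ to _+ℚ_; _*_ to _*ℚ_; _-_ to _-ℚ_)
import Data.Rational.Properties as ℚ
open import Data.Rational.Solver using (module +-*-Solver)
open import Function using (_∘_)
open import Relation.Binary.Bundles using (Setoid)
open import Relation.Binary.PropositionalEquality using (_≡_; _≢_; refl; sym; trans; cong; cong₂; module ≡-Reasoning)
import Relation.Binary.Reasoning.Setoid as SetoidReasoning
open import Relation.Nullary using (¬_; yes; no)
open import Relation.Nullary.Decidable using (dec-true; dec-false)

open +-*-Solver using (solve; _:*_; _:+_; :-_; _:-_; _:=_; con)

≤ᵇ-true : ∀ {m n} → m ≤ n → (m ≤ᵇ n) ≡ true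
≤ᵇ-true {m} {n} = dec-true (m ≤? n)

≤ᵇ-false : ∀ {m n} → ¬ m ≤ n → (m ≤ᵇ n) ≡ false
≤ᵇ-false {m} {n} = dec-false (m ≤? n)

≡ᵇ-false : ∀ {m n} → m ≢ n → (m ≡ᵇ n) ≡ false
≡ᵇ-false {m} {n} = dec-false (m ≟ n)

∸≡1⇒≡suc : ∀ {j A} → j ∸ A ≡ 1 → j ≡ suc A
∸≡1⇒≡suc {j} {A} j∸A≡1 = trans (sym (ℕ.m+[n∸m]≡n A≤j)) (trans (cong (λ n → A + n) j∸A≡1) (ℕ.+-comm A 1))
  where
  A≤j : A ≤ j
  A≤j = ℕ.<⇒≤ (ℕ.m∸n≢0⇒n<m (λ j∸A≡0 → ℕ.1+n≢0 (trans (sym j∸A≡1) j∸A≡0)))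

shift : {A : Set} → A → (ℕ → A) → ℕ → A
shift z f zero    = z
shift z f (suc j) = f j

δ : ℕ → ℕ → ℕ
δ zero    zero    = 1
δ zero    (suc j) = 0
δ (suc k) zero    = 0
δ (suc k) (suc j) = δ k j

δ-diag : ∀ k → δ k k ≡ 1
δ-diag zero    = refl
δ-diag (suc k) = δ-diag k

δ-offDiag : ∀ {k j} → j ≢ k → δ k j ≡ 0
δ-offDiag {zero}  {zero}  j≢k = ⊥-elim (j≢k refl)
δ-offDiag {zero}  {suc j} j≢k = refl
δ-offDiag {suc k} {zero}  j≢k = refl
δ-offDiag {suc k} {suc j} j≢k = δ-offDiag (j≢k ∘ cong suc)

shiftedBinomial : ℕ → ℕ → ℕ → ℕ
shiftedBinomial r zero    zero    = 0
shiftedBinomial r zero    (suc j) = r C suc j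
shiftedBinomial r (suc k) zero    = 0
shiftedBinomial r (suc k) (suc j) = shiftedBinomial r k j

shiftedBinomial-≤ : ∀ r {k j} → j ≤ k → shiftedBinomial r k j ≡ 0
shiftedBinomial-≤ r {zero}  {zero}  _         = refl
shiftedBinomial-≤ r {suc k} {zero}  _         = refl
shiftedBinomial-≤ r {suc k} {suc j} (s≤s j≤k) = shiftedBinomial-≤ r j≤k

shiftedBinomial-> : ∀ r {k j} → k < j → shiftedBinomial r k j ≡ r C (j ∸ k)
shiftedBinomial-> r {zero}  {suc j} _         = refl
shiftedBinomial-> r {suc k} {suc j} (s≤s k<j) = shiftedBinomial-> r k<j

shiftedBinomial-top : ∀ r k → shiftedBinomial r k (suc (k + r)) ≡ 0
shiftedBinomial-top r zero    = k>n⇒nCk≡0 (ℕ.n<1+n r)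
shiftedBinomial-top r (suc k) = shiftedBinomial-top r k

shiftedBinomial-pascal : ∀ r k j →
  shiftedBinomial (suc r) k j ≡ shift 0 (shiftedBinomial r k) j + shiftedBinomial r k j + δ (suc k) j
shiftedBinomial-pascal r zero    zero          = refl
shiftedBinomial-pascal r zero    (suc zero)    = trans (sym (nCk+nC[k+1]≡[n+1]C[k+1] r 0)) (ℕ.+-comm 1 (r C 1))
shiftedBinomial-pascal r zero    (suc (suc j)) = trans (sym (nCk+nC[k+1]≡[n+1]C[k+1] r (suc j))) (sym (ℕ.+-identityʳ _))
shiftedBinomial-pascal r (suc k) zero          = refl
shiftedBinomial-pascal r (suc k) (suc j)       =
  trans (shiftedBinomial-pascal r k j) (cong (λ x → x + shiftedBinomial r k j + δ (suc k) j) (shift-suc j))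
  where
  shift-suc : ∀ j → shift 0 (shiftedBinomial r k) j ≡ shiftedBinomial r (suc k) j
  shift-suc zero    = refl
  shift-suc (suc j) = refl

fromℕ≡mkℚ : ∀ n → fromℕ n ≡ mkℚ (+ n) 0 (Coprimality.sym (Coprimality.1-coprimeTo n))
fromℕ≡mkℚ n = ℚ.normalize-coprime (Coprimality.sym (Coprimality.1-coprimeTo n))

fromℕ-homo-* : ∀ m n → fromℕ (m * n) ≡ fromℕ m *ℚ fromℕ n
fromℕ-homo-* m n rewrite fromℕ≡mkℚ m | fromℕ≡mkℚ n = cong (_/ 1) (ℤ.pos-* m n)

fromℕ-homo-+ : ∀ m n → fromℕ (m + n) ≡ fromℕ m +ℚ fromℕ n
fromℕ-homo-+ m n rewrite fromℕ≡mkℚ m | fromℕ≡mkℚ n =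
  cong (_/ 1) (trans (ℤ.pos-+ m n) (sym (cong₂ ℤ._+_ (ℤ.*-identityʳ (+ m)) (ℤ.*-identityʳ (+ n)))))

1/n*n≡1 : ∀ n .{{_ : NonZero n}} → (+ 1 / n) *ℚ fromℕ n ≡ 1ℚ
1/n*n≡1 n@(suc _) = begin
  (+ 1 / n) *ℚ fromℕ n  ≡⟨ cong₂ _*ℚ_ (ℚ.normalize-coprime (Coprimality.1-coprimeTo n)) (fromℕ≡mkℚ n) ⟩
  1/ n/1 *ℚ n/1         ≡⟨ ℚ.*-inverseˡ n/1 ⟩
  1ℚ                    ∎
  where
  open ≡-Reasoning
  n/1 = mkℚ (+ n) 0 (Coprimality.sym (Coprimality.1-coprimeTo n))

inv!*n!≡1 : ∀ n → inv! n *ℚ fromℕ (n !) ≡ 1ℚ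
inv!*n!≡1 n = 1/n*n≡1 (n !) {{n ℕ.!≢0}}

inverse-unique : ∀ {x y z} → x *ℚ z ≡ 1ℚ → y *ℚ z ≡ 1ℚ → x ≡ y
inverse-unique {x} {y} {z} xz≡1 yz≡1 = begin
  x              ≡⟨ sym (trans (cong (x *ℚ_) yz≡1) (ℚ.*-identityʳ x)) ⟩
  x *ℚ (y *ℚ z)  ≡⟨ solve 3 (λ x y z → x :* (y :* z) := (x :* z) :* y) refl x y z ⟩
  (x *ℚ z) *ℚ y  ≡⟨ trans (cong (_*ℚ y) xz≡1) (ℚ.*-identityˡ y) ⟩
  y              ∎
  where open ≡-Reasoning

open CommutativeSemigroupProperties (CommutativeMonoid.commutativeSemigroup ℚ.*-1-commutativeMonoid)
  using () renaming (interchange to *-interchange)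

binomial*inv! : ∀ {n k} → k ≤ n → fromℕ (n C k) *ℚ inv! n ≡ inv! k *ℚ inv! (n ∸ k)
binomial*inv! {n} {k} k≤n = inverse-unique {z = k! *ℚ [n∸k]!} lhs≡1 rhs≡1
  where
  open ≡-Reasoning
  k! [n∸k]! : ℚ
  k!     = fromℕ (k !)
  [n∸k]! = fromℕ ((n ∸ k) !)
  nCk*k!*[n∸k]!≡n! : (n C k) * (k ! * (n ∸ k) !) ≡ n !
  nCk*k!*[n∸k]!≡n! = trans (cong (_* (k ! * (n ∸ k) !)) (nCk≡n!/k![n-k]! k≤n)) (ℕ.m/n*n≡m {{_}} (k![n∸k]!∣n! k≤n))
  fromℕ[nCk]*k!*[n∸k]!≡n! : fromℕ (n C k) *ℚ (k! *ℚ [n∸k]!) ≡ fromℕ (n !)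
  fromℕ[nCk]*k!*[n∸k]!≡n! = begin
    fromℕ (n C k) *ℚ (k! *ℚ [n∸k]!)           ≡⟨ cong (fromℕ (n C k) *ℚ_) (fromℕ-homo-* (k !) ((n ∸ k) !)) ⟨
    fromℕ (n C k) *ℚ fromℕ (k ! * (n ∸ k) !)   ≡⟨ fromℕ-homo-* (n C k) (k ! * (n ∸ k) !) ⟨
    fromℕ ((n C k) * (k ! * (n ∸ k) !))        ≡⟨ cong fromℕ nCk*k!*[n∸k]!≡n! ⟩
    fromℕ (n !)                                ∎
  lhs≡1 : (fromℕ (n C k) *ℚ inv! n) *ℚ (k! *ℚ [n∸k]!) ≡ 1ℚ
  lhs≡1 = begin
    (fromℕ (n C k) *ℚ inv! n) *ℚ (k! *ℚ [n∸k]!)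
      ≡⟨ solve 4 (λ c i x y → (c :* i) :* (x :* y) := i :* (c :* (x :* y))) refl (fromℕ (n C k)) (inv! n) k! [n∸k]! ⟩
    inv! n *ℚ (fromℕ (n C k) *ℚ (k! *ℚ [n∸k]!))  ≡⟨ cong (inv! n *ℚ_) fromℕ[nCk]*k!*[n∸k]!≡n! ⟩
    inv! n *ℚ fromℕ (n !)                        ≡⟨ inv!*n!≡1 n ⟩
    1ℚ                                           ∎
  rhs≡1 : (inv! k *ℚ inv! (n ∸ k)) *ℚ (k! *ℚ [n∸k]!) ≡ 1ℚ
  rhs≡1 = trans (*-interchange (inv! k) (inv! (n ∸ k)) k! [n∸k]!) (cong₂ _*ℚ_ (inv!*n!≡1 k) (inv!*n!≡1 (n ∸ k)))

recip*inv! : ∀ k → recip (suc k) *ℚ inv! k ≡ inv! (suc k)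
recip*inv! k = inverse-unique lhs≡1 (inv!*n!≡1 (suc k))
  where
  lhs≡1 : (recip (suc k) *ℚ inv! k) *ℚ fromℕ (suc k !) ≡ 1ℚ
  lhs≡1 = begin
    (r *ℚ inv! k) *ℚ fromℕ (suc k * k !)            ≡⟨ cong ((r *ℚ inv! k) *ℚ_) (fromℕ-homo-* (suc k) (k !)) ⟩
    (r *ℚ inv! k) *ℚ (fromℕ (suc k) *ℚ fromℕ (k !))  ≡⟨ *-interchange r (inv! k) (fromℕ (suc k)) (fromℕ (k !)) ⟩
    (r *ℚ fromℕ (suc k)) *ℚ (inv! k *ℚ fromℕ (k !))  ≡⟨ cong₂ _*ℚ_ (1/n*n≡1 (suc k)) (inv!*n!≡1 k) ⟩
    1ℚ                                               ∎
    where
    open ≡-Reasoning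
    r = recip (suc k)

module FiniteSum {c ℓ} (M : CommutativeMonoid c ℓ) where

  open CommutativeMonoid M
    using (Carrier; _∙_; ε; setoid; ∙-cong; ∙-congˡ; ∙-congʳ; identityˡ; identityʳ; assoc; commutativeSemigroup)
    renaming (_≈_ to _≃_; refl to ≃-refl; sym to ≃-sym; trans to ≃-trans)
  open SetoidReasoning setoid

  -- Opaque so that unification sees ∑ n f as is, and the summand f of a lemma can be inferred.
  opaque
    ∑ : ℕ → (ℕ → Carrier) → Carrier
    ∑ zero    f = ε
    ∑ (suc n) f = f 0 ∙ ∑ n (f ∘ suc)

    ∑-0 : ∀ f → ∑ 0 f ≡ ε
    ∑-0 f = refl

    ∑-suc : ∀ n f → ∑ (suc n) f ≡ f 0 ∙ ∑ n (f ∘ suc)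
    ∑-suc n f = refl

    foldr-applyUpTo : ∀ n (h : ℕ → ℕ) (f : ℕ → Carrier) →
                      foldr (λ i acc → f i ∙ acc) ε (applyUpTo h n) ≡ ∑ n (f ∘ h)
    foldr-applyUpTo zero    h f = refl
    foldr-applyUpTo (suc n) h f = cong (f (h 0) ∙_) (foldr-applyUpTo n (h ∘ suc) f)

    ∑-cong : ∀ n {f g} → (∀ i → i < n → f i ≃ g i) → ∑ n f ≃ ∑ n g
    ∑-cong zero    f≈g = ≃-refl
    ∑-cong (suc n) f≈g = ∙-cong (f≈g 0 (s≤s z≤n)) (∑-cong n (λ i i<n → f≈g (suc i) (s≤s i<n)))

    ∑-vanishing : ∀ n {f} → (∀ i → i < n → f i ≃ ε) → ∑ n f ≃ ε
    ∑-vanishing n {f} f≈ε = ≃-trans (∑-cong n f≈ε) (∑-ε n)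
      where
      ∑-ε : ∀ n → ∑ n (λ _ → ε) ≃ ε
      ∑-ε zero    = ≃-refl
      ∑-ε (suc n) = ≃-trans (∙-congˡ (∑-ε n)) (identityˡ ε)

    ∑-distrib-∙ : ∀ n f g → ∑ n (λ i → f i ∙ g i) ≃ ∑ n f ∙ ∑ n g
    ∑-distrib-∙ zero    f g = ≃-sym (identityˡ ε)
    ∑-distrib-∙ (suc n) f g = ≃-trans (∙-congˡ (∑-distrib-∙ n _ _)) (interchange _ _ _ _)
      where open CommutativeSemigroupProperties commutativeSemigroup using (interchange)

    ∑-comm : ∀ m n (f : ℕ → ℕ → Carrier) → ∑ m (λ i → ∑ n (f i)) ≃ ∑ n (λ j → ∑ m (λ i → f i j))
    ∑-comm zero    n f = ≃-sym (∑-vanishing n (λ _ _ → ≃-refl))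
    ∑-comm (suc m) n f = ≃-trans (∙-congˡ (∑-comm m n (f ∘ suc))) (≃-sym (∑-distrib-∙ n (f 0) _))

    ∑-split : ∀ m n f → ∑ (m + n) f ≃ ∑ m f ∙ ∑ n (λ t → f (m + t))
    ∑-split zero    n f = ≃-sym (identityˡ _)
    ∑-split (suc m) n f = ≃-trans (∙-congˡ (∑-split m n (f ∘ suc))) (≃-sym (assoc _ _ _))

    ∑-dropZeros : ∀ m n f → (∀ i → i < m → f i ≃ ε) → ∑ (m + n) f ≃ ∑ n (λ t → f (m + t))
    ∑-dropZeros m n f f≈ε = begin
      ∑ (m + n) f                          ≈⟨ ∑-split m n f ⟩
      ∑ m f ∙ ∑ n (λ t → f (m + t))        ≈⟨ ∙-congʳ (∑-vanishing m f≈ε) ⟩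
      ε ∙ ∑ n (λ t → f (m + t))            ≈⟨ identityˡ _ ⟩
      ∑ n (λ t → f (m + t))                ∎

    ∑-truncate : ∀ {m} n {f} → m ≤ n → (∀ i → m ≤ i → f i ≃ ε) → ∑ n f ≃ ∑ m f
    ∑-truncate {m} n {f} m≤n f≈ε = begin
      ∑ n f                                            ≡⟨ cong (λ k → ∑ k f) (sym (ℕ.m+[n∸m]≡n m≤n)) ⟩
      ∑ (m + (n ∸ m)) f                                ≈⟨ ∑-split m (n ∸ m) f ⟩
      ∑ m f ∙ ∑ (n ∸ m) (λ t → f (m + t))
        ≈⟨ ∙-congˡ (∑-vanishing (n ∸ m) (λ t _ → f≈ε (m + t) (ℕ.m≤m+n m t))) ⟩
      ∑ m f ∙ ε                                        ≈⟨ identityʳ _ ⟩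
      ∑ m f                                            ∎

    ∑-lastZero : ∀ n {f} → f n ≃ ε → ∑ (suc n) f ≃ ∑ n f
    ∑-lastZero zero    fn≈ε = ≃-trans (identityʳ _) fn≈ε
    ∑-lastZero (suc n) fn≈ε = ∙-congˡ (∑-lastZero n fn≈ε)

    ∑-single : ∀ n q {f} → q < n → (∀ i → i < n → i ≢ q → f i ≃ ε) → ∑ n f ≃ f q
    ∑-single (suc n) zero    _         f≈ε =
      ≃-trans (∙-congˡ (∑-vanishing n (λ i i<n → f≈ε (suc i) (s≤s i<n) λ ()))) (identityʳ _)
    ∑-single (suc n) (suc q) (s≤s q<n) f≈ε = begin
      _ ≈⟨ ∙-congʳ (f≈ε 0 (s≤s z≤n) λ ()) ⟩
      _ ≈⟨ identityˡ _ ⟩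
      _ ≈⟨ ∑-single n q q<n (λ i i<n i≢q → f≈ε (suc i) (s≤s i<n) (i≢q ∘ ℕ.suc-injective)) ⟩
      _ ∎

module _ {a b ℓ₁ ℓ₂} (M : CommutativeMonoid a ℓ₁) (N : CommutativeMonoid b ℓ₂) where

  private
    module M = CommutativeMonoid M
    module N = CommutativeMonoid N
    module ∑M = FiniteSum M
    module ∑N = FiniteSum N

  ∑-homo : (h : M.Carrier → N.Carrier) → (∀ x y → h (x M.∙ y) N.≈ h x N.∙ h y) → h M.ε N.≈ N.ε →
           ∀ n f → h (∑M.∑ n f) N.≈ ∑N.∑ n (h ∘ f)
  ∑-homo h h-∙ h-ε zero    f = begin
    h (∑M.∑ 0 f)   ≡⟨ cong h (∑M.∑-0 f) ⟩
    h M.ε          ≈⟨ h-ε ⟩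
    N.ε            ≡⟨ ∑N.∑-0 (h ∘ f) ⟨
    ∑N.∑ 0 (h ∘ f) ∎
    where open SetoidReasoning N.setoid
  ∑-homo h h-∙ h-ε (suc n) f = begin
    h (∑M.∑ (suc n) f)                   ≡⟨ cong h (∑M.∑-suc n f) ⟩
    h (f 0 M.∙ ∑M.∑ n (f ∘ suc))         ≈⟨ h-∙ _ _ ⟩
    h (f 0) N.∙ h (∑M.∑ n (f ∘ suc))     ≈⟨ N.∙-congˡ (∑-homo h h-∙ h-ε n (f ∘ suc)) ⟩
    h (f 0) N.∙ ∑N.∑ n (h ∘ f ∘ suc)     ≡⟨ ∑N.∑-suc n (h ∘ f) ⟨
    ∑N.∑ (suc n) (h ∘ f)                 ∎
    where open SetoidReasoning N.setoid

≈-setoid : Setoid _ _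
≈-setoid = record
  { Carrier = Lie ; _≈_ = _≈_
  ; isEquivalence = record { refl = ≈-refl ; sym = ≈-sym ; trans = ≈-trans } }

+-isAbelianGroup : IsAbelianGroup _≈_ _+ᴸ_ 0ᴸ -ᴸ_
+-isAbelianGroup = record
  { isGroup = record
    { isMonoid = record
      { isSemigroup = record
        { isMagma = record { isEquivalence = Setoid.isEquivalence ≈-setoid ; ∙-cong = +-cong }
        ; assoc = +-assoc }
      ; identity = comm∧idˡ⇒id +-comm +-identity }
    ; inverse = comm∧invˡ⇒inv +-comm +-inverse
    ; ⁻¹-cong = ·-cong }
  ; comm = +-comm }
  where open Consequences ≈-setoid

+-abelianGroup : AbelianGroup _ _
+-abelianGroup = record { isAbelianGroup = +-isAbelianGroup }

open AbelianGroup +-abelianGroup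
  using (reflexive)
  renaming (identityʳ to +-identityʳ; ∙-congˡ to +-congˡ; ∙-congʳ to +-congʳ; commutativeMonoid to +-commutativeMonoid)
open GroupProperties (AbelianGroup.group +-abelianGroup)
  using (identityˡ-unique; inverseˡ-unique; ⁻¹-involutive)
module ≈-Reasoning = SetoidReasoning ≈-setoid

·-congʳ : ∀ {c d x} → c ≡ d → c ·ᴸ x ≈ d ·ᴸ x
·-congʳ refl = ≈-refl

·-zeroˡ : ∀ x → 0ℚ ·ᴸ x ≈ 0ᴸ
·-zeroˡ x = identityˡ-unique (0ℚ ·ᴸ x) (0ℚ ·ᴸ x) (≈-sym (·-distribʳ 0ℚ 0ℚ x))

·-zeroʳ : ∀ c → c ·ᴸ 0ᴸ ≈ 0ᴸ
·-zeroʳ c = identityˡ-unique (c ·ᴸ 0ᴸ) (c ·ᴸ 0ᴸ)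
  (≈-trans (≈-sym (·-distribˡ c 0ᴸ 0ᴸ)) (·-cong (+-identity 0ᴸ)))

⁅⁆-zeroʳ : ∀ x → ⁅ x , 0ᴸ ⁆ ≈ 0ᴸ
⁅⁆-zeroʳ x = begin
  ⁅ x , 0ᴸ ⁆          ≈⟨ br-cong ≈-refl (≈-sym (·-zeroˡ 0ᴸ)) ⟩
  ⁅ x , 0ℚ ·ᴸ 0ᴸ ⁆    ≈⟨ br-·ʳ 0ℚ x 0ᴸ ⟩
  0ℚ ·ᴸ ⁅ x , 0ᴸ ⁆    ≈⟨ ·-zeroˡ _ ⟩
  0ᴸ                  ∎
  where open ≈-Reasoning

⁅⁆-anticomm : ∀ x y → ⁅ x , y ⁆ +ᴸ ⁅ y , x ⁆ ≈ 0ᴸ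
⁅⁆-anticomm x y = begin
  ⁅ x , y ⁆ +ᴸ ⁅ y , x ⁆                                 ≈⟨ +-cong (≈-sym (+-identity _)) (≈-sym (+-identityʳ _)) ⟩
  (0ᴸ +ᴸ ⁅ x , y ⁆) +ᴸ (⁅ y , x ⁆ +ᴸ 0ᴸ)                 ≈⟨ +-cong (+-congʳ (≈-sym (br-alt x))) (+-congˡ (≈-sym (br-alt y))) ⟩
  (⁅ x , x ⁆ +ᴸ ⁅ x , y ⁆) +ᴸ (⁅ y , x ⁆ +ᴸ ⁅ y , y ⁆)   ≈⟨ ≈-sym (+-cong (br-+ʳ x x y) (br-+ʳ y x y)) ⟩
  ⁅ x , x +ᴸ y ⁆ +ᴸ ⁅ y , x +ᴸ y ⁆                       ≈⟨ ≈-sym (br-+ˡ x y (x +ᴸ y)) ⟩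
  ⁅ x +ᴸ y , x +ᴸ y ⁆                                    ≈⟨ br-alt _ ⟩
  0ᴸ                                                     ∎
  where open ≈-Reasoning

⁅⁆-antisym : ∀ x y → ⁅ x , y ⁆ ≈ -ᴸ ⁅ y , x ⁆
⁅⁆-antisym x y = inverseˡ-unique _ _ (⁅⁆-anticomm x y)

⁅⁆-leibniz : ∀ z x y → ⁅ z , ⁅ x , y ⁆ ⁆ ≈ ⁅ ⁅ z , x ⁆ , y ⁆ +ᴸ ⁅ x , ⁅ z , y ⁆ ⁆
⁅⁆-leibniz z x y = begin
  ⁅ z , ⁅ x , y ⁆ ⁆                  ≈⟨ inverseˡ-unique _ _ (≈-trans (≈-sym (+-assoc _ _ _)) (jacobi z x y)) ⟩
  -ᴸ (⁅ x , ⁅ y , z ⁆ ⁆ +ᴸ ⁅ y , ⁅ z , x ⁆ ⁆) ≈⟨ ·-distribˡ _ _ _ ⟩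
  -ᴸ ⁅ x , ⁅ y , z ⁆ ⁆ +ᴸ -ᴸ ⁅ y , ⁅ z , x ⁆ ⁆ ≈⟨ +-comm _ _ ⟩
  -ᴸ ⁅ y , ⁅ z , x ⁆ ⁆ +ᴸ -ᴸ ⁅ x , ⁅ y , z ⁆ ⁆
    ≈⟨ +-cong (≈-trans (·-cong (⁅⁆-antisym y _)) (⁻¹-involutive _))
              (≈-trans (≈-sym (br-·ʳ _ x _)) (br-cong ≈-refl (≈-sym (⁅⁆-antisym z y)))) ⟩
  ⁅ ⁅ z , x ⁆ , y ⁆ +ᴸ ⁅ x , ⁅ z , y ⁆ ⁆ ∎
  where open ≈-Reasoning

module L = FiniteSum +-commutativeMonoid
module Q = FiniteSum ℚ.+-0-commutativeMonoid

ΣL≡∑ : ∀ lo hi f → ΣL lo hi f ≡ L.∑ (suc hi ∸ lo) (λ i → f (lo + i))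
ΣL≡∑ lo hi f = L.foldr-applyUpTo (suc hi ∸ lo) (λ i → lo + i) f

Σℚ≡∑ : ∀ n f → Σℚ 0 n f ≡ Q.∑ (suc n) f
Σℚ≡∑ n f = Q.foldr-applyUpTo (suc n) (λ i → 0 + i) f

·-∑ : ∀ c n f → c ·ᴸ L.∑ n f ≈ L.∑ n (λ i → c ·ᴸ f i)
·-∑ c = ∑-homo +-commutativeMonoid +-commutativeMonoid (c ·ᴸ_) (·-distribˡ c) (·-zeroʳ c)

∑-· : ∀ x n w → Q.∑ n w ·ᴸ x ≈ L.∑ n (λ i → w i ·ᴸ x)
∑-· x = ∑-homo ℚ.+-0-commutativeMonoid +-commutativeMonoid (_·ᴸ x) (λ c d → ·-distribʳ c d x) (·-zeroˡ x)

⁅⁆-∑ : ∀ z n f → ⁅ z , L.∑ n f ⁆ ≈ L.∑ n (λ i → ⁅ z , f i ⁆)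
⁅⁆-∑ z = ∑-homo +-commutativeMonoid +-commutativeMonoid ⁅ z ,_⁆ (br-+ʳ z) (⁅⁆-zeroʳ z)

*-∑ : ∀ c n f → c *ℚ Q.∑ n f ≡ Q.∑ n (λ i → c *ℚ f i)
*-∑ c = ∑-homo ℚ.+-0-commutativeMonoid ℚ.+-0-commutativeMonoid (c *ℚ_) (ℚ.*-distribˡ-+ c) (ℚ.*-zeroʳ c)

ad-a^b : ℕ → Lie
ad-a^b m = ad-a^ m (gen b)

bracketTerm : ℕ → (ℕ → ℚ) → ℕ → Lie
bracketTerm N c j = c j ·ᴸ ⁅ ad-a^b j , ad-a^b (N ∸ j) ⁆

bracketSum : ℕ → (ℕ → ℚ) → Lie
bracketSum N c = L.∑ (suc N) (bracketTerm N c)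

bracketSum-cong : ∀ N {c d} → (∀ j → j ≤ N → c j ≡ d j) → bracketSum N c ≈ bracketSum N d
bracketSum-cong N c≡d = L.∑-cong (suc N) (λ j j≤N → ·-congʳ (c≡d j (ℕ.≤-pred j≤N)))

bracketSum-zero : ∀ N {c} → (∀ j → j ≤ N → c j ≡ 0ℚ) → bracketSum N c ≈ 0ᴸ
bracketSum-zero N c≡0 = L.∑-vanishing (suc N) (λ j j≤N → ≈-trans (·-congʳ (c≡0 j (ℕ.≤-pred j≤N))) (·-zeroˡ _))

bracketSum-single : ∀ N q {c} → q ≤ N → (∀ j → j ≤ N → j ≢ q → c j ≡ 0ℚ) →
                    bracketSum N c ≈ c q ·ᴸ ⁅ ad-a^b q , ad-a^b (N ∸ q) ⁆
bracketSum-single N q q≤N c≡0 =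
  L.∑-single (suc N) q (s≤s q≤N) (λ j j≤N j≢q → ≈-trans (·-congʳ (c≡0 j (ℕ.≤-pred j≤N) j≢q)) (·-zeroˡ _))

bracketSum-+ : ∀ N c d → bracketSum N c +ᴸ bracketSum N d ≈ bracketSum N (λ j → c j +ℚ d j)
bracketSum-+ N c d = ≈-trans (≈-sym (L.∑-distrib-∙ (suc N) (bracketTerm N c) (bracketTerm N d)))
                             (L.∑-cong (suc N) (λ j _ → ≈-sym (·-distribʳ (c j) (d j) _)))

bracketSum-· : ∀ N w c → w ·ᴸ bracketSum N c ≈ bracketSum N (λ j → w *ℚ c j)
bracketSum-· N w c = ≈-trans (·-∑ w (suc N) (bracketTerm N c)) (L.∑-cong (suc N) (λ j _ → ≈-sym (·-assoc w (c j) _)))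

bracketSum-∑ : ∀ N M (c : ℕ → ℕ → ℚ) → L.∑ M (λ i → bracketSum N (c i)) ≈ bracketSum N (λ j → Q.∑ M (λ i → c i j))
bracketSum-∑ N M c = begin
  L.∑ M (λ i → bracketSum N (c i))                          ≈⟨ L.∑-comm M (suc N) (λ i → bracketTerm N (c i)) ⟩
  L.∑ (suc N) (λ j → L.∑ M (λ i → bracketTerm N (c i) j))
    ≈⟨ L.∑-cong (suc N) (λ j _ → ≈-sym (∑-· ⁅ ad-a^b j , ad-a^b (N ∸ j) ⁆ M (λ i → c i j))) ⟩
  bracketSum N (λ j → Q.∑ M (λ i → c i j))                  ∎
  where open ≈-Reasoning

ad-a-bracketSum : ∀ N c → c (suc N) ≡ 0ℚ → ⁅ gen a , bracketSum N c ⁆ ≈ bracketSum (suc N) (λ j → shift 0ℚ c j +ℚ c j)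
ad-a-bracketSum N c c[1+N]≡0 = begin
  ⁅ gen a , bracketSum N c ⁆                 ≈⟨ ⁅⁆-∑ (gen a) (suc N) _ ⟩
  L.∑ (suc N) (λ j → ⁅ gen a , c j ·ᴸ ⁅ e j , e (N ∸ j) ⁆ ⁆)
    ≈⟨ L.∑-cong (suc N) (λ j _ → ≈-trans (br-·ʳ (c j) (gen a) _)
                                  (≈-trans (·-cong (⁅⁆-leibniz (gen a) (e j) (e (N ∸ j)))) (·-distribˡ (c j) _ _))) ⟩
  L.∑ (suc N) (λ j → raiseˡ j +ᴸ raiseʳ j) ≈⟨ L.∑-distrib-∙ (suc N) raiseˡ raiseʳ ⟩
  L.∑ (suc N) raiseˡ +ᴸ L.∑ (suc N) raiseʳ  ≈⟨ +-cong raiseˡ≈ raiseʳ≈ ⟩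
  bracketSum (suc N) (shift 0ℚ c) +ᴸ bracketSum (suc N) c ≈⟨ bracketSum-+ (suc N) (shift 0ℚ c) c ⟩
  bracketSum (suc N) (λ j → shift 0ℚ c j +ℚ c j) ∎
  where
  open ≈-Reasoning
  e = ad-a^b
  raiseˡ raiseʳ : ℕ → Lie
  raiseˡ j = c j ·ᴸ ⁅ e (suc j) , e (N ∸ j) ⁆
  raiseʳ j = c j ·ᴸ ⁅ e j , e (suc (N ∸ j)) ⁆
  raiseˡ≈ : L.∑ (suc N) raiseˡ ≈ bracketSum (suc N) (shift 0ℚ c)
  raiseˡ≈ = ≈-sym (begin
    bracketSum (suc N) (shift 0ℚ c)                                  ≡⟨ L.∑-suc (suc N) (bracketTerm (suc N) (shift 0ℚ c)) ⟩
    0ℚ ·ᴸ ⁅ e 0 , e (suc N) ⁆ +ᴸ L.∑ (suc N) raiseˡ                  ≈⟨ +-congʳ (·-zeroˡ _) ⟩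
    0ᴸ +ᴸ L.∑ (suc N) raiseˡ                                         ≈⟨ +-identity _ ⟩
    L.∑ (suc N) raiseˡ                                               ∎)
  raiseʳ≈ : L.∑ (suc N) raiseʳ ≈ bracketSum (suc N) c
  raiseʳ≈ = ≈-sym (≈-trans (L.∑-lastZero (suc N) (≈-trans (·-congʳ c[1+N]≡0) (·-zeroˡ _)))
    (L.∑-cong (suc N) (λ j j≤N → ·-cong (br-cong ≈-refl (reflexive (cong e (ℕ.+-∸-assoc 1 (ℕ.≤-pred j≤N))))))))

D-ad-coeff : ℕ → ℕ → ℕ → ℚ
D-ad-coeff k r j = - (inv! k *ℚ fromℕ (shiftedBinomial r k j))

D-ad-coeff-zero : ∀ k r j → shiftedBinomial r k j ≡ 0 → D-ad-coeff k r j ≡ 0ℚ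
D-ad-coeff-zero k r j eq = trans (cong (λ m → - (inv! k *ℚ fromℕ m)) eq) (cong -_ (ℚ.*-zeroʳ (inv! k)))

D-ad-coeff-pascal : ∀ k r j →
  D-ad-coeff k (suc r) j ≡ - (inv! k *ℚ fromℕ (δ (suc k) j)) +ℚ (shift 0ℚ (D-ad-coeff k r) j +ℚ D-ad-coeff k r j)
D-ad-coeff-pascal k r j = begin
  - (i *ℚ fromℕ (shiftedBinomial (suc r) k j))
    ≡⟨ cong (λ m → - (i *ℚ fromℕ m)) (shiftedBinomial-pascal r k j) ⟩
  - (i *ℚ fromℕ (s + t + d))
    ≡⟨ cong (λ q → - (i *ℚ q)) (trans (fromℕ-homo-+ (s + t) d) (cong (_+ℚ fromℕ d) (fromℕ-homo-+ s t))) ⟩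
  - (i *ℚ (fromℕ s +ℚ fromℕ t +ℚ fromℕ d))
    ≡⟨ solve 4 (λ i s t d → :- (i :* (s :+ t :+ d)) := :- (i :* d) :+ (:- (i :* s) :+ :- (i :* t)))
               refl i (fromℕ s) (fromℕ t) (fromℕ d) ⟩
  - (i *ℚ fromℕ d) +ℚ (- (i *ℚ fromℕ s) +ℚ - (i *ℚ fromℕ t))
    ≡⟨ cong (λ q → - (i *ℚ fromℕ d) +ℚ (q +ℚ - (i *ℚ fromℕ t))) (shift-coeff j) ⟩
  - (i *ℚ fromℕ d) +ℚ (shift 0ℚ (D-ad-coeff k r) j +ℚ D-ad-coeff k r j) ∎
  where
  open ≡-Reasoning
  i = inv! k
  s = shift 0 (shiftedBinomial r k) j
  t = shiftedBinomial r k j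
  d = δ (suc k) j
  shift-coeff : ∀ j → - (i *ℚ fromℕ (shift 0 (shiftedBinomial r k) j)) ≡ shift 0ℚ (D-ad-coeff k r) j
  shift-coeff zero    = cong -_ (ℚ.*-zeroʳ i)
  shift-coeff (suc j) = refl

⁅⁅φ,a⁆,ad-a^b⁆ : ∀ k r →
  ⁅ ⁅ φ (suc k) , gen a ⁆ , ad-a^b r ⁆ ≈ bracketSum (suc (k + r)) (λ j → - (inv! k *ℚ fromℕ (δ (suc k) j)))
⁅⁅φ,a⁆,ad-a^b⁆ k r = begin
  ⁅ ⁅ inv! k ·ᴸ ad-a^b k , gen a ⁆ , ad-a^b r ⁆
    ≈⟨ br-cong (≈-trans (br-·ˡ (inv! k) _ _) (·-cong (⁅⁆-antisym (ad-a^b k) (gen a)))) ≈-refl ⟩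
  ⁅ inv! k ·ᴸ (-ᴸ ad-a^b (suc k)) , ad-a^b r ⁆
    ≈⟨ br-cong (≈-sym (·-assoc (inv! k) _ _)) ≈-refl ⟩
  ⁅ (inv! k *ℚ (0ℚ -ℚ 1ℚ)) ·ᴸ ad-a^b (suc k) , ad-a^b r ⁆
    ≈⟨ br-·ˡ _ _ _ ⟩
  (inv! k *ℚ (0ℚ -ℚ 1ℚ)) ·ᴸ ⁅ ad-a^b (suc k) , ad-a^b r ⁆
    ≈⟨ ·-congʳ (solve 1 (λ i → i :* (con 0ℚ :- con 1ℚ) := :- (i :* con 1ℚ)) refl (inv! k)) ⟩
  (- (inv! k *ℚ 1ℚ)) ·ᴸ ⁅ ad-a^b (suc k) , ad-a^b r ⁆
    ≈⟨ ·-cong (br-cong ≈-refl (reflexive (cong ad-a^b (sym (ℕ.m+n∸m≡n (suc k) r))))) ⟩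
  (- (inv! k *ℚ 1ℚ)) ·ᴸ ⁅ ad-a^b (suc k) , ad-a^b (suc (k + r) ∸ suc k) ⁆
    ≈⟨ ·-congʳ (cong (λ m → - (inv! k *ℚ fromℕ m)) (sym (δ-diag k))) ⟩
  (- (inv! k *ℚ fromℕ (δ (suc k) (suc k)))) ·ᴸ ⁅ ad-a^b (suc k) , ad-a^b (suc (k + r) ∸ suc k) ⁆
    ≈⟨ ≈-sym (bracketSum-single (suc (k + r)) (suc k) (s≤s (ℕ.m≤m+n k r))
         (λ j _ j≢1+k → trans (cong (λ m → - (inv! k *ℚ fromℕ m)) (δ-offDiag j≢1+k)) (cong -_ (ℚ.*-zeroʳ (inv! k))))) ⟩
  bracketSum (suc (k + r)) (λ j → - (inv! k *ℚ fromℕ (δ (suc k) j))) ∎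
  where open ≈-Reasoning

D-φ-ad-a^b : ∀ k r → D (φ (suc k)) (ad-a^b r) ≈ bracketSum (k + r) (D-ad-coeff k r)
D-φ-ad-a^b k zero    = ≈-sym (bracketSum-zero (k + 0) (λ j j≤k+0 →
  D-ad-coeff-zero k 0 j (shiftedBinomial-≤ 0 (ℕ.≤-trans j≤k+0 (ℕ.≤-reflexive (ℕ.+-identityʳ k))))))
D-φ-ad-a^b k (suc r) = begin
  ⁅ ⁅ φ (suc k) , gen a ⁆ , ad-a^b r ⁆ +ᴸ ⁅ gen a , D (φ (suc k)) (ad-a^b r) ⁆
    ≈⟨ +-cong (⁅⁅φ,a⁆,ad-a^b⁆ k r)
              (≈-trans (br-cong ≈-refl (D-φ-ad-a^b k r)) (ad-a-bracketSum (k + r) (D-ad-coeff k r) top≡0)) ⟩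
  bracketSum (suc (k + r)) (λ j → - (inv! k *ℚ fromℕ (δ (suc k) j)))
    +ᴸ bracketSum (suc (k + r)) (λ j → shift 0ℚ (D-ad-coeff k r) j +ℚ D-ad-coeff k r j)
    ≈⟨ bracketSum-+ (suc (k + r)) _ _ ⟩
  bracketSum (suc (k + r)) (λ j → - (inv! k *ℚ fromℕ (δ (suc k) j)) +ℚ (shift 0ℚ (D-ad-coeff k r) j +ℚ D-ad-coeff k r j))
    ≈⟨ bracketSum-cong (suc (k + r)) (λ j _ → sym (D-ad-coeff-pascal k r j)) ⟩
  bracketSum (suc (k + r)) (D-ad-coeff k (suc r))
    ≡⟨ cong (λ N → bracketSum N (D-ad-coeff k (suc r))) (sym (ℕ.+-suc k r)) ⟩
  bracketSum (k + suc r) (D-ad-coeff k (suc r)) ∎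
  where
  open ≈-Reasoning
  top≡0 : D-ad-coeff k r (suc (k + r)) ≡ 0ℚ
  top≡0 = D-ad-coeff-zero k r (suc (k + r)) (shiftedBinomial-top r k)

D-φ-φ-coeff : ℕ → ℕ → ℕ → ℚ
D-φ-φ-coeff k N j = if j ≤ᵇ k then 0ℚ else - (inv! k *ℚ inv! (j ∸ k) *ℚ inv! (N ∸ j))

inv!*D-ad-coeff : ∀ {k N j} → j ≤ N → inv! (N ∸ k) *ℚ D-ad-coeff k (N ∸ k) j ≡ D-φ-φ-coeff k N j
inv!*D-ad-coeff {k} {N} {j} j≤N with j ≤? k
... | yes j≤k rewrite ≤ᵇ-true j≤k =
  trans (cong (inv! m *ℚ_) (D-ad-coeff-zero k m j (shiftedBinomial-≤ m j≤k))) (ℚ.*-zeroʳ (inv! m))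
  where m = N ∸ k
... | no j≰k rewrite ≤ᵇ-false j≰k = begin
  inv! m *ℚ - (inv! k *ℚ fromℕ (shiftedBinomial m k j))
    ≡⟨ cong (λ n → inv! m *ℚ - (inv! k *ℚ fromℕ n)) (shiftedBinomial-> m k<j) ⟩
  inv! m *ℚ - (inv! k *ℚ fromℕ (m C (j ∸ k)))
    ≡⟨ solve 3 (λ x y z → x :* (:- (y :* z)) := :- (y :* (z :* x))) refl (inv! m) (inv! k) (fromℕ (m C (j ∸ k))) ⟩
  - (inv! k *ℚ (fromℕ (m C (j ∸ k)) *ℚ inv! m))
    ≡⟨ cong (λ q → - (inv! k *ℚ q)) (binomial*inv! (ℕ.∸-monoˡ-≤ k j≤N)) ⟩
  - (inv! k *ℚ (inv! (j ∸ k) *ℚ inv! (m ∸ (j ∸ k))))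
    ≡⟨ cong (λ n → - (inv! k *ℚ (inv! (j ∸ k) *ℚ inv! n))) m∸[j∸k]≡N∸j ⟩
  - (inv! k *ℚ (inv! (j ∸ k) *ℚ inv! (N ∸ j)))
    ≡⟨ cong -_ (sym (ℚ.*-assoc (inv! k) _ _)) ⟩
  - (inv! k *ℚ inv! (j ∸ k) *ℚ inv! (N ∸ j))
    ∎
  where
  open ≡-Reasoning
  m = N ∸ k
  k<j : k < j
  k<j = ℕ.≰⇒> j≰k
  m∸[j∸k]≡N∸j : m ∸ (j ∸ k) ≡ N ∸ j
  m∸[j∸k]≡N∸j = trans (ℕ.∸-+-assoc N k (j ∸ k)) (cong (N ∸_) (ℕ.m+[n∸m]≡n (ℕ.<⇒≤ k<j)))

D-φ-φ : ∀ {k N} → k ≤ N → D (φ (suc k)) (φ (suc (N ∸ k))) ≈ bracketSum N (D-φ-φ-coeff k N)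
D-φ-φ {k} {N} k≤N = begin
  inv! m ·ᴸ D (φ (suc k)) (ad-a^b m)                        ≈⟨ ·-cong (D-φ-ad-a^b k m) ⟩
  inv! m ·ᴸ bracketSum (k + m) (D-ad-coeff k m)             ≈⟨ bracketSum-· (k + m) (inv! m) (D-ad-coeff k m) ⟩
  bracketSum (k + m) (λ j → inv! m *ℚ D-ad-coeff k m j)     ≡⟨ cong (λ n → bracketSum n (λ j → inv! m *ℚ D-ad-coeff k m j)) k+m≡N ⟩
  bracketSum N (λ j → inv! m *ℚ D-ad-coeff k m j)           ≈⟨ bracketSum-cong N (λ j j≤N → inv!*D-ad-coeff j≤N) ⟩
  bracketSum N (D-φ-φ-coeff k N)                            ∎
  where
  open ≈-Reasoning
  m = N ∸ k
  k+m≡N : k + m ≡ N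
  k+m≡N = ℕ.m+[n∸m]≡n k≤N

bernoulliTerm : (ℕ → ℚ) → ℕ → ℕ → ℚ
bernoulliTerm β r i = if r ≤ᵇ i then 0ℚ else β i *ℚ inv! i *ℚ inv! (r ∸ i)

binomial*D-φ-φ-coeff : ∀ (β : ℕ → ℚ) A t N j →
  fromℕ ((A + t) C t) *ℚ β t *ℚ D-φ-φ-coeff (A + t) N j ≡ - (inv! A *ℚ inv! (N ∸ j)) *ℚ bernoulliTerm β (j ∸ A) t
binomial*D-φ-φ-coeff β A t N j with j ≤? A + t
... | yes j≤A+t rewrite ≤ᵇ-true j≤A+t | ≤ᵇ-true (ℕ.m≤n+o⇒m∸n≤o j A j≤A+t) =
  trans (ℚ.*-zeroʳ (fromℕ ((A + t) C t) *ℚ β t)) (sym (ℚ.*-zeroʳ (- (inv! A *ℚ inv! (N ∸ j)))))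
... | no j≰A+t
  rewrite ≤ᵇ-false j≰A+t | ≤ᵇ-false (λ j∸A≤t → j≰A+t (ℕ.≤-trans (ℕ.m≤n+m∸n j A) (ℕ.+-monoʳ-≤ A j∸A≤t))) = begin
  c *ℚ β t *ℚ - (inv! (A + t) *ℚ inv! (j ∸ (A + t)) *ℚ inv! (N ∸ j))
    ≡⟨ solve 5 (λ c b i x y → c :* b :* (:- (i :* x :* y)) := :- ((c :* i) :* b :* x :* y)) refl c (β t) (inv! (A + t)) _ _ ⟩
  - ((c *ℚ inv! (A + t)) *ℚ β t *ℚ inv! (j ∸ (A + t)) *ℚ inv! (N ∸ j))
    ≡⟨ cong₂ (λ x n → - (x *ℚ β t *ℚ inv! n *ℚ inv! (N ∸ j))) c*inv!≡ (sym (ℕ.∸-+-assoc j A t)) ⟩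
  - ((inv! t *ℚ inv! A) *ℚ β t *ℚ inv! (j ∸ A ∸ t) *ℚ inv! (N ∸ j))
    ≡⟨ solve 5 (λ i a b x y → :- ((i :* a) :* b :* x :* y) := :- (a :* y) :* (b :* i :* x)) refl (inv! t) (inv! A) (β t) _ _ ⟩
  - (inv! A *ℚ inv! (N ∸ j)) *ℚ (β t *ℚ inv! t *ℚ inv! (j ∸ A ∸ t)) ∎
  where
  open ≡-Reasoning
  c = fromℕ ((A + t) C t)
  c*inv!≡ : c *ℚ inv! (A + t) ≡ inv! t *ℚ inv! A
  c*inv!≡ = trans (binomial*inv! (ℕ.m≤n+m t A)) (cong (λ n → inv! t *ℚ inv! n) (ℕ.m+n∸n≡m A t))

coef-below : ∀ β q′ {i} → i < q′ → coef β (suc (suc q′)) (suc i) ≡ 0ℚ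
coef-below β q′ {i} i<q′ rewrite ≤ᵇ-false {suc (suc q′)} {suc (suc i)} (ℕ.<⇒≱ i<q′ ∘ ℕ.≤-pred ∘ ℕ.≤-pred) = refl

coef-above : ∀ β q′ t → coef β (suc (suc q′)) (suc (q′ + t)) ≡ fromℕ ((q′ + t) C t) *ℚ β t *ℚ recip (suc q′)
coef-above β q′ t rewrite ≤ᵇ-true {suc (suc q′)} {suc (suc (q′ + t))} (s≤s (s≤s (ℕ.m≤m+n q′ t))) =
  cong (λ s → fromℕ ((q′ + t) C s) *ℚ β s *ℚ recip (suc q′)) (ℕ.m+n∸m≡n q′ t)

module _ (β : ℕ → ℚ) (bern : IsBernoulli β) where

  ∑-bernoulliTerm : ∀ {r M} → r < M → Q.∑ M (bernoulliTerm β r) ≡ (if r ≡ᵇ 1 then 1ℚ else 0ℚ)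
  ∑-bernoulliTerm {r} {M} r<M = begin
    Q.∑ M (bernoulliTerm β r)         ≡⟨ Q.∑-truncate M r<M vanishing ⟩
    Q.∑ (suc r) (bernoulliTerm β r)   ≡⟨ sym (Σℚ≡∑ r (bernoulliTerm β r)) ⟩
    Σℚ 0 r (bernoulliTerm β r)        ≡⟨ bern r ⟩
    (if r ≡ᵇ 1 then 1ℚ else 0ℚ)       ∎
    where
    open ≡-Reasoning
    vanishing : ∀ i → suc r ≤ i → bernoulliTerm β r i ≡ 0ℚ
    vanishing i r<i = cong (λ c → if c then 0ℚ else β i *ℚ inv! i *ℚ inv! (r ∸ i)) (≤ᵇ-true (ℕ.<⇒≤ r<i))

  ∑-binomial*D-φ-φ-coeff : ∀ A M′ {j} → j ≤ A + suc M′ →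
    Q.∑ (suc (suc M′)) (λ t → fromℕ ((A + t) C t) *ℚ β t *ℚ D-φ-φ-coeff (A + t) (A + suc M′) j)
      ≡ - (inv! A *ℚ inv! (A + suc M′ ∸ j)) *ℚ (if j ∸ A ≡ᵇ 1 then 1ℚ else 0ℚ)
  ∑-binomial*D-φ-φ-coeff A M′ {j} j≤N = begin
    Q.∑ (suc (suc M′)) (λ t → fromℕ ((A + t) C t) *ℚ β t *ℚ D-φ-φ-coeff (A + t) N j)
      ≡⟨ Q.∑-cong (suc (suc M′)) (λ t _ → binomial*D-φ-φ-coeff β A t N j) ⟩
    Q.∑ (suc (suc M′)) (λ t → K *ℚ bernoulliTerm β (j ∸ A) t)
      ≡⟨ sym (*-∑ K (suc (suc M′)) (bernoulliTerm β (j ∸ A))) ⟩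
    K *ℚ Q.∑ (suc (suc M′)) (bernoulliTerm β (j ∸ A))
      ≡⟨ cong (K *ℚ_) (∑-bernoulliTerm (s≤s (ℕ.m≤n+o⇒m∸n≤o j A j≤N))) ⟩
    K *ℚ (if j ∸ A ≡ᵇ 1 then 1ℚ else 0ℚ) ∎
    where
    open ≡-Reasoning
    N = A + suc M′
    K = - (inv! A *ℚ inv! (N ∸ j))

  ∑-binomial·D-φ-φ : ∀ A M′ →
    L.∑ (suc (suc M′)) (λ t → (fromℕ ((A + t) C t) *ℚ β t) ·ᴸ D (φ (suc (A + t))) (φ (suc (suc M′ ∸ t))))
      ≈ (- (inv! A *ℚ inv! M′)) ·ᴸ ⁅ ad-a^b (suc A) , ad-a^b M′ ⁆
  ∑-binomial·D-φ-φ A M′ = begin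
    L.∑ M (λ t → w t ·ᴸ D (φ (suc (A + t))) (φ (suc (suc M′ ∸ t))))
      ≈⟨ L.∑-cong M (λ t t<M → term t (ℕ.≤-pred t<M)) ⟩
    L.∑ M (λ t → bracketSum N (λ j → w t *ℚ D-φ-φ-coeff (A + t) N j))
      ≈⟨ bracketSum-∑ N M (λ t j → w t *ℚ D-φ-φ-coeff (A + t) N j) ⟩
    bracketSum N (λ j → Q.∑ M (λ t → w t *ℚ D-φ-φ-coeff (A + t) N j))
      ≈⟨ bracketSum-cong N (λ j j≤N → ∑-binomial*D-φ-φ-coeff A M′ j≤N) ⟩
    bracketSum N (λ j → K j *ℚ (if j ∸ A ≡ᵇ 1 then 1ℚ else 0ℚ))
      ≈⟨ bracketSum-single N (suc A) 1+A≤N offDiagonal ⟩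
    (K (suc A) *ℚ (if suc A ∸ A ≡ᵇ 1 then 1ℚ else 0ℚ)) ·ᴸ ⁅ ad-a^b (suc A) , ad-a^b (N ∸ suc A) ⁆
      ≡⟨ cong₂ (λ x n → x ·ᴸ ⁅ ad-a^b (suc A) , ad-a^b n ⁆) diagonal N∸[1+A]≡M′ ⟩
    (- (inv! A *ℚ inv! M′)) ·ᴸ ⁅ ad-a^b (suc A) , ad-a^b M′ ⁆ ∎
    where
    open ≈-Reasoning
    M = suc (suc M′)
    N = A + suc M′
    w : ℕ → ℚ
    w t = fromℕ ((A + t) C t) *ℚ β t
    K : ℕ → ℚ
    K j = - (inv! A *ℚ inv! (N ∸ j))
    1+A≤N : suc A ≤ N
    1+A≤N = ℕ.≤-trans (ℕ.m≤m+n (suc A) M′) (ℕ.≤-reflexive (sym (ℕ.+-suc A M′)))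
    N∸[1+A]≡M′ : N ∸ suc A ≡ M′
    N∸[1+A]≡M′ = trans (cong (_∸ suc A) (ℕ.+-suc A M′)) (ℕ.m+n∸m≡n (suc A) M′)
    term : ∀ t → t ≤ suc M′ →
           w t ·ᴸ D (φ (suc (A + t))) (φ (suc (suc M′ ∸ t))) ≈ bracketSum N (λ j → w t *ℚ D-φ-φ-coeff (A + t) N j)
    term t t≤1+M′ = ≈-trans
      (·-cong (≈-trans (reflexive (cong (λ n → D (φ (suc (A + t))) (φ (suc n))) (sym (ℕ.[m+n]∸[m+o]≡n∸o A (suc M′) t))))
                       (D-φ-φ (ℕ.+-monoʳ-≤ A t≤1+M′))))
      (bracketSum-· N (w t) (D-φ-φ-coeff (A + t) N))
    offDiagonal : ∀ j → j ≤ N → j ≢ suc A → K j *ℚ (if j ∸ A ≡ᵇ 1 then 1ℚ else 0ℚ) ≡ 0ℚ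
    offDiagonal j _ j≢1+A rewrite ≡ᵇ-false (j≢1+A ∘ ∸≡1⇒≡suc {j} {A}) = ℚ.*-zeroʳ (K j)
    diagonal : K (suc A) *ℚ (if suc A ∸ A ≡ᵇ 1 then 1ℚ else 0ℚ) ≡ - (inv! A *ℚ inv! M′)
    diagonal rewrite ℕ.m+n∸n≡m 1 A | N∸[1+A]≡M′ = ℚ.*-identityʳ _

  -- N is left abstract so that both halves of identity (ii), which share one N, fit this form.
  ∑-coef·D-φ-φ : ∀ q′ M′ {N} → q′ + suc M′ ≡ N →
    L.∑ (suc N) (λ i → coef β (suc (suc q′)) (suc i) ·ᴸ D (φ (suc i)) (φ (suc N ∸ i)))
      ≈ (- (inv! (suc q′) *ℚ inv! M′)) ·ᴸ ⁅ ad-a^b (suc q′) , ad-a^b M′ ⁆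
  ∑-coef·D-φ-φ q′ M′ refl = begin
    L.∑ (suc (q′ + suc M′)) g                ≡⟨ cong (λ n → L.∑ n g) (sym (ℕ.+-suc q′ (suc M′))) ⟩
    L.∑ (q′ + suc (suc M′)) g
      ≈⟨ L.∑-dropZeros q′ (suc (suc M′)) g (λ i i<q′ → ≈-trans (·-congʳ (coef-below β q′ i<q′)) (·-zeroˡ _)) ⟩
    L.∑ (suc (suc M′)) (λ t → g (q′ + t))    ≈⟨ L.∑-cong (suc (suc M′)) (λ t t< → term t (ℕ.≤-pred t<)) ⟩
    L.∑ (suc (suc M′)) (λ t → r ·ᴸ h t)      ≈⟨ ≈-sym (·-∑ r (suc (suc M′)) h) ⟩
    r ·ᴸ L.∑ (suc (suc M′)) h                ≈⟨ ·-cong (∑-binomial·D-φ-φ q′ M′) ⟩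
    r ·ᴸ ((- (inv! q′ *ℚ inv! M′)) ·ᴸ X)     ≈⟨ ≈-sym (·-assoc r _ X) ⟩
    (r *ℚ - (inv! q′ *ℚ inv! M′)) ·ᴸ X       ≡⟨ cong (_·ᴸ X) coefficient ⟩
    (- (inv! (suc q′) *ℚ inv! M′)) ·ᴸ X      ∎
    where
    open ≈-Reasoning
    r = recip (suc q′)
    X = ⁅ ad-a^b (suc q′) , ad-a^b M′ ⁆
    g h : ℕ → Lie
    g i = coef β (suc (suc q′)) (suc i) ·ᴸ D (φ (suc i)) (φ (suc (q′ + suc M′) ∸ i))
    h t = (fromℕ ((q′ + t) C t) *ℚ β t) ·ᴸ D (φ (suc (q′ + t))) (φ (suc (suc M′ ∸ t)))
    index : ∀ t → t ≤ suc M′ → suc (q′ + suc M′) ∸ (q′ + t) ≡ suc (suc M′ ∸ t)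
    index t t≤1+M′ = trans (cong (_∸ (q′ + t)) (sym (ℕ.+-suc q′ (suc M′))))
      (trans (ℕ.[m+n]∸[m+o]≡n∸o q′ (suc (suc M′)) t) (ℕ.+-∸-assoc 1 t≤1+M′))
    term : ∀ t → t ≤ suc M′ → g (q′ + t) ≈ r ·ᴸ h t
    term t t≤1+M′ = ≈-trans
      (≈-trans (·-congʳ (trans (coef-above β q′ t) (ℚ.*-comm _ r)))
               (·-cong (reflexive (cong (λ n → D (φ (suc (q′ + t))) (φ n)) (index t t≤1+M′)))))
      (·-assoc r _ _)
    coefficient : r *ℚ - (inv! q′ *ℚ inv! M′) ≡ - (inv! (suc q′) *ℚ inv! M′)
    coefficient = trans (solve 3 (λ r x y → r :* (:- (x :* y)) := :- ((r :* x) :* y)) refl r (inv! q′) (inv! M′))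
                        (cong (λ x → - (x *ℚ inv! M′)) (recip*inv! q′))

  ΣL-binomial·D-φ-φ≈0 : (n : ℕ) → 2 ≤ n →
    ΣL 0 n (λ i → (fromℕ ((n ∸ 2 + i) C (n ∸ 2)) *ℚ β i) ·ᴸ D (φ (n ∸ 1 + i)) (φ (n + 1 ∸ i))) ≈ 0ᴸ
  ΣL-binomial·D-φ-φ≈0 (suc zero) (s≤s ())
  ΣL-binomial·D-φ-φ≈0 n@(suc (suc n′)) _ = begin
    ΣL 0 n f
      ≡⟨ ΣL≡∑ 0 n f ⟩
    L.∑ (suc n) (λ i → (fromℕ ((n′ + i) C n′) *ℚ β i) ·ᴸ D (φ (suc (n′ + i))) (φ (n + 1 ∸ i)))
      ≈⟨ L.∑-cong (suc n) (λ i i≤n → reflexive (cong₂ (λ c m → (fromℕ c *ℚ β i) ·ᴸ D (φ (suc (n′ + i))) (φ m))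
                                                  (binomial-sym i) (index i (ℕ.≤-pred i≤n)))) ⟩
    L.∑ (suc n) (λ t → (fromℕ ((n′ + t) C t) *ℚ β t) ·ᴸ D (φ (suc (n′ + t))) (φ (suc (n ∸ t))))
      ≈⟨ ∑-binomial·D-φ-φ n′ (suc n′) ⟩
    (- (inv! n′ *ℚ inv! (suc n′))) ·ᴸ ⁅ ad-a^b (suc n′) , ad-a^b (suc n′) ⁆
      ≈⟨ ≈-trans (·-cong (br-alt _)) (·-zeroʳ _) ⟩
    0ᴸ ∎
    where
    open ≈-Reasoning
    f : ℕ → Lie
    f i = (fromℕ ((n ∸ 2 + i) C (n ∸ 2)) *ℚ β i) ·ᴸ D (φ (n ∸ 1 + i)) (φ (n + 1 ∸ i))
    binomial-sym : ∀ i → (n′ + i) C n′ ≡ (n′ + i) C i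
    binomial-sym i = trans (nCk≡nC[n∸k] (ℕ.m≤m+n n′ i)) (cong ((n′ + i) C_) (ℕ.m+n∸m≡n n′ i))
    index : ∀ i → i ≤ n → n + 1 ∸ i ≡ suc (n ∸ i)
    index i i≤n = trans (ℕ.+-∸-comm 1 i≤n) (ℕ.+-comm (n ∸ i) 1)

  ΣL-coef·D-φ-φ≈0 : (n p : ℕ) → 2 ≤ n → 2 ≤ p →
    ΣL 1 (n + p ∸ 1) (λ i → (coef β p i +ℚ coef β n i) ·ᴸ D (φ i) (φ (n + p ∸ i))) ≈ 0ᴸ
  ΣL-coef·D-φ-φ≈0 (suc zero) _ (s≤s ()) _
  ΣL-coef·D-φ-φ≈0 (suc (suc _)) (suc zero) _ (s≤s ())
  ΣL-coef·D-φ-φ≈0 n@(suc (suc n′)) p@(suc (suc p′)) _ _ = begin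
    ΣL 1 (n + p ∸ 1) f
      ≡⟨ ΣL≡∑ 1 (n + p ∸ 1) f ⟩
    L.∑ (suc N) (λ i → (coef β p (suc i) +ℚ coef β n (suc i)) ·ᴸ Dᵢ i)
      ≈⟨ L.∑-cong (suc N) (λ i _ → ·-distribʳ (coef β p (suc i)) (coef β n (suc i)) (Dᵢ i)) ⟩
    L.∑ (suc N) (λ i → coef β p (suc i) ·ᴸ Dᵢ i +ᴸ coef β n (suc i) ·ᴸ Dᵢ i)
      ≈⟨ L.∑-distrib-∙ (suc N) (λ i → coef β p (suc i) ·ᴸ Dᵢ i) (λ i → coef β n (suc i) ·ᴸ Dᵢ i) ⟩
    L.∑ (suc N) (λ i → coef β p (suc i) ·ᴸ Dᵢ i) +ᴸ L.∑ (suc N) (λ i → coef β n (suc i) ·ᴸ Dᵢ i)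
      ≈⟨ +-cong (∑-coef·D-φ-φ p′ (suc n′) N-sym) (∑-coef·D-φ-φ n′ (suc p′) refl) ⟩
    x ·ᴸ ⁅ eₚ , eₙ ⁆ +ᴸ (- (inv! (suc n′) *ℚ inv! (suc p′))) ·ᴸ ⁅ eₙ , eₚ ⁆
      ≡⟨ cong (λ y → x ·ᴸ ⁅ eₚ , eₙ ⁆ +ᴸ (- y) ·ᴸ ⁅ eₙ , eₚ ⁆) (ℚ.*-comm (inv! (suc n′)) (inv! (suc p′))) ⟩
    x ·ᴸ ⁅ eₚ , eₙ ⁆ +ᴸ x ·ᴸ ⁅ eₙ , eₚ ⁆
      ≈⟨ ≈-sym (·-distribˡ x _ _) ⟩
    x ·ᴸ (⁅ eₚ , eₙ ⁆ +ᴸ ⁅ eₙ , eₚ ⁆)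
      ≈⟨ ≈-trans (·-cong (⁅⁆-anticomm eₚ eₙ)) (·-zeroʳ x) ⟩
    0ᴸ ∎
    where
    open ≈-Reasoning
    f : ℕ → Lie
    f i = (coef β p i +ℚ coef β n i) ·ᴸ D (φ i) (φ (n + p ∸ i))
    N = n′ + suc (suc p′)
    Dᵢ : ℕ → Lie
    Dᵢ i = D (φ (suc i)) (φ (suc N ∸ i))
    eₚ = ad-a^b (suc p′)
    eₙ = ad-a^b (suc n′)
    x = - (inv! (suc p′) *ℚ inv! (suc n′))
    N-sym : p′ + suc (suc n′) ≡ N
    N-sym = trans (ℕ.+-suc p′ (suc n′)) (trans (cong suc (ℕ.+-suc p′ n′)) (sym (ℕ.+-comm n′ (suc (suc p′)))))

mainTheorem5 : (β : ℕ → ℚ) → IsBernoulli β →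
    ((n : ℕ) → 2 ≤ n →
      ΣL 0 n (λ i → (fromℕ ((n ∸ 2 + i) C (n ∸ 2)) *ℚ β i) ·ᴸ D (φ (n ∸ 1 + i)) (φ (n + 1 ∸ i))) ≈ 0ᴸ)
    × ((n p : ℕ) → 2 ≤ n → 2 ≤ p →
      ΣL 1 (n + p ∸ 1) (λ i → (coef β p i +ℚ coef β n i) ·ᴸ D (φ i) (φ (n + p ∸ i))) ≈ 0ᴸ)
mainTheorem5 β bern = ΣL-binomial·D-φ-φ≈0 β bern , ΣL-coef·D-φ-φ≈0 β bern
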